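{- Let $\mathfrak{M}$ be a (deterministic or non-deterministic) cathoristic model and $\phi$ a cathoristic logic formula. If $\mathfrak{M}\models\phi$ then $[\![\mathfrak{M}]\!]\models[\![\phi]\!]$ in Hennessy–Milner logic.
   Context: Fix a non-empty set $\Sigma$ of actions. Cathoristic formulae: $\phi ::= \top \mid \phi\land\psi \mid \langle a\rangle\phi \mid\ !A$ with $a\in\Sigma$, $A$ a finite subset of $\Sigma$. A (possibly non-deterministic) cathoristic transition system is $\mathcal{L}=(S,\rightarrow,\lambda)$ with $\rightarrow\subseteq S\times\Sigma\times S$ and $\lambda:S\to\mathcal{P}(\Sigma)$ such that $\{a\mid\exists t.\,s\xrightarrow{a}t\}\subseteq\lambda(s)$ and each $\lambda(s)$ is finite or $\Sigma$; it is deterministic if $s\xrightarrow{a}t$, $s\xrightarrow{a}t'$ imply $t=t'$. A cathoristic model is $(\mathcal{L},s)$, $s\in S$. Satisfaction: $\top$ always; $\land$ componentwise; $(\mathcal{L},s)\models\langle a\rangle\phi$ iff some $s\xrightarrow{a}t$ has $(\mathcal{L},t)\models\phi$; $(\mathcal{L},s)\models\ !A$ iff $\lambda(s)\subseteq A$. Hennessy–Milner logic formulae: $\phi ::= \top \mid \bigwedge_{i\in I}\phi_i \mid \langle a\rangle\phi \mid \neg\phi$ (index sets $I$ possibly infinite), interpreted over pairs $((S,\rightarrow),s)$ with $(S,\rightarrow)$ a labelled transition system over $\Sigma$: $\top$ always; $\bigwedge_i\phi_i$ iff all $\phi_i$; $\langle a\rangle\phi$ iff some $s\xrightarrow{a}s'$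 satisfies $\phi$; $\neg\phi$ iff not $\phi$. Translation: $[\![\top]\!]=\top$, $[\![\phi_1\land\phi_2]\!]=[\![\phi_1]\!]\land[\![\phi_2]\!]$, $[\![\langle a\rangle\phi]\!]=\langle a\rangle[\![\phi]\!]$, $[\![!A]\!]=\bigwedge_{a\in\Sigma\setminus A}\neg\langle a\rangle\top$; and $[\![((S,\rightarrow,\lambda),s)]\!]=((S,\rightarrow),s)$. -}

module Defs where

open import Level using (Level; suc; _⊔_)
open import Data.List using (List)
open import Data.List.Membership.Propositional using (_∈_)
open import Data.Product using (Σ; ∃; _×_; _,_)
open import Data.Sum using (_⊎_)
open import Data.Unit using (⊤)
open import Data.Bool using (Bool; true; false)
open import Relation.Nullary using (¬_)
open import Relation.Binary.PropositionalEquality using (_≡_)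

data CForm (Act : Set) : Set where
  ctop  : CForm Act
  _∧_   : CForm Act → CForm Act → CForm Act
  ⟨_⟩_  : Act → CForm Act → CForm Act
  !_    : List Act → CForm Act

data HML (Act : Set) : Set₁ where
  htop : HML Act
  ⋀    : (I : Set) → (I → HML Act) → HML Act
  ⟨_⟩ₕ_ : Act → HML Act → HML Act
  ¬ₕ_  : HML Act → HML Act

record LTS (Act : Set) : Set₁ where
  field
    State : Set
    _⟶[_]_ : State → Act → State → Set

-- Cathoristic transition system (possibly non-deterministic)
-- λ(s) is given as a predicate on Act.
record CTS (Act : Set) : Set₁ where
  field
    State  : Set
    _⟶[_]_ : State → Act → State → Set
    lab    : State → Act → Set
    trans⊆lab : ∀ {s a t} → s ⟶[ a ] t → lab s a
    -- λ(s) is finite or all of Σ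
    labFinOrAll : ∀ s → (Σ (List Act) λ A → ∀ a → (lab s a → a ∈ A) × (a ∈ A → lab s a))
                        ⊎ (∀ a → lab s a)

Deterministic : {Act : Set} → CTS Act → Set
Deterministic L = ∀ {s a t t'} → s ⟶[ a ] t → s ⟶[ a ] t' → t ≡ t'
  where open CTS L

_,_⊨_ : {Act : Set} → (L : CTS Act) → CTS.State L → CForm Act → Set
L , s ⊨ ctop = ⊤
L , s ⊨ (φ ∧ ψ) = (L , s ⊨ φ) × (L , s ⊨ ψ)
L , s ⊨ (⟨ a ⟩ φ) = ∃ λ t → CTS._⟶[_]_ L s a t × (L , t ⊨ φ)
L , s ⊨ (! A) = ∀ a → CTS.lab L s a → a ∈ A

_,_⊨ₕ_ : {Act : Set} → (T : LTS Act) → LTS.State T → HML Act → Set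
T , s ⊨ₕ htop = ⊤
T , s ⊨ₕ ⋀ I φs = ∀ (i : I) → T , s ⊨ₕ φs i
T , s ⊨ₕ (⟨ a ⟩ₕ φ) = ∃ λ t → LTS._⟶[_]_ T s a t × (T , t ⊨ₕ φ)
T , s ⊨ₕ (¬ₕ φ) = ¬ (T , s ⊨ₕ φ)

⟦_⟧ : {Act : Set} → CForm Act → HML Act
⟦ ctop ⟧ = htop
⟦ φ ∧ ψ ⟧ = ⋀ Bool (λ { true → ⟦ φ ⟧ ; false → ⟦ ψ ⟧ })
⟦ ⟨ a ⟩ φ ⟧ = ⟨ a ⟩ₕ ⟦ φ ⟧
⟦_⟧ {Act} (! A) = ⋀ (Σ Act λ a → ¬ (a ∈ A)) (λ { (a , _) → ¬ₕ (⟨ a ⟩ₕ htop) })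

⟦_⟧ₗ : {Act : Set} → CTS Act → LTS Act
⟦ L ⟧ₗ = record { State = CTS.State L ; _⟶[_]_ = CTS._⟶[_]_ L }

module Submission where

-- The one case with content is the tantum
-- formula !A: its translation forbids every transition labelled outside A.
-- This follows from the defining constraint of a cathoristic transition
-- system that every outgoing action lies in λ(s), combined with λ(s) ⊆ A;
-- it is isolated as the lemma `no-transition-outside`.

open import Defs
open import Data.Bool using (true; false)
open import Data.List using (List)
open import Data.List.Membership.Propositional using (_∈_)
open import Data.Product using (_,_)
open import Data.Unit using (tt)
open import Relation.Nullary using (¬_)

no-transition-outside : {Act : Set} (L : CTS Act) {s : CTS.State L} {A : List Act}
  → L , s ⊨ (! A) → ∀ {a t} → ¬ (a ∈ A) → ¬ CTS._⟶[_]_ L s a t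
no-transition-outside L λs⊆A a∉A s⟶t = a∉A (λs⊆A _ (CTS.trans⊆lab L s⟶t))

mainTheorem16 : {Act : Set} → Act → (L : CTS Act) → (s : CTS.State L) → (φ : CForm Act)
    → L , s ⊨ φ → ⟦ L ⟧ₗ , s ⊨ₕ ⟦ φ ⟧
mainTheorem16 _ L s ctop      tt               = tt
mainTheorem16 x L s (φ ∧ ψ)   (s⊨φ , _) true   = mainTheorem16 x L s φ s⊨φ
mainTheorem16 x L s (φ ∧ ψ)   (_ , s⊨ψ) false  = mainTheorem16 x L s ψ s⊨ψ
mainTheorem16 x L s (⟨ a ⟩ φ) (t , s⟶t , t⊨φ) = t , s⟶t , mainTheorem16 x L t φ t⊨φ
mainTheorem16 _ L s (! A)     λs⊆A (a , a∉A) (t , s⟶t , _) =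
  no-transition-outside L λs⊆A a∉A s⟶t
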